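{- Let $p$ be an odd prime and let $k$ be a positive integer with $\gcd(k,p-1)=1$. Let $\tau_{k,p}$ be the permutation of $\{1,2,\dots,p-1\}$ defined by $\tau_{k,p}(i)=\{i^k\}_p$, where $\{a\}_p$ denotes the least nonnegative residue of $a$ modulo $p$. Then $$\operatorname{sgn}(\tau_{k,p})=\begin{cases}1&\text{if } p\equiv 3\pmod 4,\\ (-1)^{\frac{k-1}{2}}&\text{if } p\equiv 1\pmod 4.\end{cases}$$
   Context: $\operatorname{sgn}(\pi)$ is $1$ if the permutation $\pi$ is even and $-1$ if it is odd. The hypothesis $\gcd(k,p-1)=1$ guarantees that $i\mapsto\{i^k\}_p$ is a bijection of $\{1,\dots,p-1\}$. -}

module Defs where

open import Data.Nat using (ℕ; zero; suc; _+_; _*_; _^_; _<ᵇ_; _%_; NonZero)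
open import Data.Nat.Primality using (Prime)
open import Data.Bool using (if_then_else_)
open import Data.List using (List; map; concatMap; upTo)
open import Data.Nat.ListAction using (sum)
open import Data.Integer using (ℤ; -_) renaming (+_ to ⁺_)

neg1^ : ℕ → ℤ
neg1^ zero = ⁺ 1
neg1^ (suc n) = - neg1^ n

-- the list [a, a+1, ..., b-1]  (i.e. a ≤ i < b)
range : ℕ → ℕ → List ℕ
range a b = map (λ x → a + x) (upTo (b Data.Nat.∸ a))

inversions : ℕ → (ℕ → ℕ) → ℕ
inversions m f =
  sum (concatMap (λ i → map (λ j → if f j <ᵇ f i then 1 else 0) (range (suc i) (suc m)))
                 (range 1 (suc m)))

sgn : ℕ → (ℕ → ℕ) → ℤ
sgn m f = neg1^ (inversions m f)

residue : (p : ℕ) .{{_ : NonZero p}} → ℕ → ℕ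
residue p a = a % p

τ : (k p : ℕ) .{{_ : NonZero p}} → ℕ → ℕ
τ k p i = residue p (i ^ k)

-- Write p = 2h + 1 and k = 2t + 1 (k is odd, being coprime to the even number p - 1).
-- As k is odd, τ(p - i) = p - τ(i), and for such centrally symmetric maps the involution
-- (i, j) ↦ (p - j, p - i) on inversions fixes exactly the inversions with i + j = p;
-- hence sgn τ = (-1)^μ with μ = #{i ≤ h : τ(i) > h}. As in Gauss's lemma, write
-- τ(i) ≡ ±‖τ(i)‖ with ‖τ(i)‖ ≤ h; since τ is a bijection (ku ≡ 1 mod p - 1 for some u),
-- i ↦ ‖τ(i)‖ permutes [1, h], so (h!)^k ≡ (-1)^μ h! and (-1)^μ ≡ (h!)^(2t) (mod p).
-- Wilson's theorem gives (h!)² ≡ (-1)^(h+1), so sgn τ = (-1)^((h+1)t): this is 1 when h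
-- is odd (p ≡ 3 mod 4) and (-1)^t = (-1)^((k-1)/2) when h is even (p ≡ 1 mod 4).

module Submission where

open import Algebra.Bundles using (CommutativeMonoid)
open import Data.Bool.Base using (true; false; if_then_else_)
open import Data.Empty using (⊥-elim)
open import Data.Integer.Base using (+_; -_)
open import Data.Integer.Properties using (neg-involutive)
open import Data.List.Base using (List; []; _∷_; [_]; _++_; map; concatMap; upTo)
open import Data.List.Properties using (map-∘; map-++; upTo-∷ʳ)
open import Data.Nat.Base
open import Data.Nat.Coprimality using (prime⇒coprime; coprime-Bézout)
open import Data.Nat.Divisibility using (_∣_; divides; ∣1⇒≡1)
open import Data.Nat.DivMod
open import Data.Nat.GCD using (gcd; GCD; gcd-GCD; gcd-greatest; module Bézout)
open import Data.Nat.ListAction using (sum)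
open import Data.Nat.ListAction.Properties using (sum-++)
open import Data.Nat.Primality using (Prime; prime⇒nonZero; prime⇒nonTrivial)
open import Data.Nat.Properties
open import Data.Nat.Tactic.RingSolver using (solve-∀)
open import Data.Product.Base using (_×_; _,_; proj₁; proj₂; ∃-syntax)
open import Data.Sum.Base using (_⊎_; inj₁; inj₂)
open import Function.Base using (_∘_; _$_; id)
open import Level using (0ℓ)
open import Relation.Binary.Bundles using (Setoid)
open import Relation.Binary.Definitions using (tri<; tri≈; tri>)
open import Relation.Binary.PropositionalEquality as ≡ using (_≡_; _≢_)
open import Relation.Nullary.Decidable using (Dec; does; yes; no; dec-true; dec-false)
open import Relation.Nullary.Negation using (¬_; contradiction)

open import Defs using (neg1^; sgn; inversions; range; τ)

*-^-distrib : ∀ a b n → (a * b) ^ n ≡ a ^ n * b ^ n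
*-^-distrib a b zero    = ≡.refl
*-^-distrib a b (suc n) = ≡.trans (≡.cong (a * b *_) (*-^-distrib a b n)) (interchange a b (a ^ n) (b ^ n))
  where
  interchange : ∀ a b x y → a * b * (x * y) ≡ a * x * (b * y)
  interchange = solve-∀

n+n≡n*2 : ∀ n → n + n ≡ n * 2
n+n≡n*2 = solve-∀

2∣n+n : ∀ n → 2 ∣ n + n
2∣n+n n = divides n (n+n≡n*2 n)

1≢n+n : ∀ n → 1 ≢ n + n
1≢n+n (suc n) 1≡2+2n = 0≢1+n (≡.trans (suc-injective 1≡2+2n) (+-suc n n))

even⊎odd : ∀ n → ∃[ c ] (n ≡ c + c ⊎ n ≡ suc (c + c))
even⊎odd zero    = 0 , inj₁ ≡.refl
even⊎odd (suc n) with even⊎odd n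
... | c , inj₁ n≡2c   = c , inj₂ (≡.cong suc n≡2c)
... | c , inj₂ n≡1+2c = suc c , inj₁ (≡.cong suc (≡.trans n≡1+2c (≡.sym (+-suc c c))))

odd⇒≡1+2[n/2] : ∀ {n} → n % 2 ≡ 1 → n ≡ suc (n / 2 + n / 2)
odd⇒≡1+2[n/2] {n} n%2≡1 = ≡.trans (m≡m%n+[m/n]*n n 2) (≡.cong₂ _+_ n%2≡1 (≡.sym (n+n≡n*2 (n / 2))))

bézout-positive : ∀ a n → 1 ≤ a → 1 ≤ n → gcd a n ≡ 1 → ∃[ u ] ∃[ v ] a * u ≡ 1 + n * v
bézout-positive a n _ _ gcd≡1 with Bézout.identity (≡.subst (GCD a n) gcd≡1 (gcd-GCD a n))
... | Bézout.+- x y 1+yn≡xa = x , y , ≡.trans (*-comm a x) (≡.trans (≡.sym 1+yn≡xa) (≡.cong suc (*-comm y n)))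
-- Here a x ≡ -1 (mod n), so u = (n - 1) x + n works.
bézout-positive (suc a) (suc n) _ _ _ | Bézout.-+ x y 1+x[1+a]≡y[1+n] =
  x * n + suc n , y * n + a , +-cancelʳ-≡ n _ _ (begin
    suc a * (x * n + suc n) + n            ≡⟨ expand-left x a n ⟩
    n * (1 + x * suc a) + suc a * suc n    ≡⟨ ≡.cong (λ z → n * z + suc a * suc n) 1+x[1+a]≡y[1+n] ⟩
    n * (y * suc n) + suc a * suc n        ≡⟨ expand-right y a n ⟩
    1 + suc n * (y * n + a) + n            ∎)
  where
  open ≡.≡-Reasoning
  expand-left : ∀ x a n → suc a * (x * n + suc n) + n ≡ n * (1 + x * suc a) + suc a * suc n
  expand-left = solve-∀
  expand-right : ∀ y a n → n * (y * suc n) + suc a * suc n ≡ 1 + suc n * (y * n + a) + n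
  expand-right = solve-∀

neg1^-+-even : ∀ a w → neg1^ (a + (w + w)) ≡ neg1^ a
neg1^-+-even a zero    = ≡.cong neg1^ (+-identityʳ a)
neg1^-+-even a (suc w) = ≡.trans (≡.cong neg1^ (two-more a w)) (≡.trans (neg-involutive _) (neg1^-+-even a w))
  where
  two-more : ∀ a w → a + (suc w + suc w) ≡ suc (suc (a + (w + w)))
  two-more = solve-∀

infix 4 _∈[1,_]
_∈[1,_] : ℕ → ℕ → Set
i ∈[1, n ] = 1 ≤ i × i ≤ n

∈[1,]-step : ∀ {i n} → i ∈[1, n ] → i ∈[1, suc n ]
∈[1,]-step (1≤i , i≤n) = 1≤i , m≤n⇒m≤1+n i≤n

∈[1,]-shrink : ∀ {i n} → i ∈[1, suc n ] → i ≢ suc n → i ∈[1, n ]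
∈[1,]-shrink (1≤i , i≤1+n) i≢1+n = 1≤i , ≤-pred (≤∧≢⇒< i≤1+n i≢1+n)

∈[1,]-last : ∀ n → suc n ∈[1, suc n ]
∈[1,]-last n = s≤s z≤n , ≤-refl

record IsBijectionOn (n : ℕ) (g g⁻¹ : ℕ → ℕ) : Set where
  field
    maps-into   : ∀ i → i ∈[1, n ] → g i ∈[1, n ]
    maps-into⁻¹ : ∀ j → j ∈[1, n ] → g⁻¹ j ∈[1, n ]
    inverseˡ    : ∀ i → i ∈[1, n ] → g⁻¹ (g i) ≡ i
    inverseʳ    : ∀ j → j ∈[1, n ] → g (g⁻¹ j) ≡ j

-- 𝟙[ x <? y ] is definitionally the term if x <ᵇ y then 1 else 0 counted by inversions.
𝟙[_] : ∀ {P : Set} → Dec P → ℕ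
𝟙[ P? ] = if does P? then 1 else 0

𝟙-yes : ∀ {P : Set} (P? : Dec P) → P → 𝟙[ P? ] ≡ 1
𝟙-yes P? p = ≡.cong (if_then 1 else 0) (dec-true P? p)

𝟙-no : ∀ {P : Set} (P? : Dec P) → ¬ P → 𝟙[ P? ] ≡ 0
𝟙-no P? ¬p = ≡.cong (if_then 1 else 0) (dec-false P? ¬p)

𝟙-cong : ∀ {P Q : Set} (P? : Dec P) (Q? : Dec Q) → (P → Q) → (Q → P) → 𝟙[ P? ] ≡ 𝟙[ Q? ]
𝟙-cong P? Q? P→Q Q→P with P? | Q?
... | yes _ | yes _ = ≡.refl
... | no  _ | no  _ = ≡.refl
... | yes p | no ¬q = contradiction (P→Q p) ¬q
... | no ¬p | yes q = contradiction (Q→P q) ¬p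

𝟙-trichotomy : ∀ x y → 𝟙[ x <? y ] + 𝟙[ x ≟ y ] + 𝟙[ y <? x ] ≡ 1
𝟙-trichotomy x y with <-cmp x y
... | tri< x<y x≢y y≮x = ≡.cong₂ _+_ (≡.cong₂ _+_ (𝟙-yes (x <? y) x<y) (𝟙-no (x ≟ y) x≢y)) (𝟙-no (y <? x) y≮x)
... | tri≈ x≮y x≡y y≮x = ≡.cong₂ _+_ (≡.cong₂ _+_ (𝟙-no (x <? y) x≮y) (𝟙-yes (x ≟ y) x≡y)) (𝟙-no (y <? x) y≮x)
... | tri> x≮y x≢y y<x = ≡.cong₂ _+_ (≡.cong₂ _+_ (𝟙-no (x <? y) x≮y) (𝟙-no (x ≟ y) x≢y)) (𝟙-yes (y <? x) y<x)

<-transpose : ∀ {x y a b} → x + a ≡ y + b → x < y → b < a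
<-transpose x+a≡y+b x<y = ≰⇒> (λ a≤b → <⇒≢ (+-mono-<-≤ x<y a≤b) x+a≡y+b)

𝟙-transpose : ∀ x y a b → x + a ≡ y + b → 𝟙[ x <? y ] ≡ 𝟙[ b <? a ]
𝟙-transpose x y a b x+a≡y+b = 𝟙-cong (x <? y) (b <? a) (<-transpose x+a≡y+b)
  (<-transpose (≡.trans (+-comm b y) (≡.trans (≡.sym x+a≡y+b) (+-comm x a))))

-- Products over an interval in a commutative monoid

module IntervalProduct {a ℓ} (M : CommutativeMonoid a ℓ) where

  open CommutativeMonoid M renaming (Carrier to A)
  open import Algebra.Properties.CommutativeSemigroup commutativeSemigroup using (interchange)
  open import Relation.Binary.Reasoning.Setoid setoid

  ∏ : ℕ → (ℕ → A) → A
  ∏ zero    F = ε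
  ∏ (suc n) F = ∏ n F ∙ F (suc n)

  only : ℕ → (ℕ → A) → ℕ → A
  only c F i = if does (i ≟ c) then F i else ε

  erase : ℕ → (ℕ → A) → ℕ → A
  erase c F i = if does (i ≟ c) then ε else F i

  ∏-cong : ∀ n {F G} → (∀ i → i ∈[1, n ] → F i ≈ G i) → ∏ n F ≈ ∏ n G
  ∏-cong zero    F≈G = refl
  ∏-cong (suc n) F≈G =
    ∙-cong (∏-cong n (λ i → F≈G i ∘ ∈[1,]-step)) (F≈G (suc n) (∈[1,]-last n))

  ∏-ε : ∀ n {F} → (∀ i → i ∈[1, n ] → F i ≈ ε) → ∏ n F ≈ ε
  ∏-ε zero    F≈ε = refl
  ∏-ε (suc n) F≈ε =
    trans (∙-cong (∏-ε n (λ i → F≈ε i ∘ ∈[1,]-step)) (F≈ε (suc n) (∈[1,]-last n))) (identityˡ ε)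

  ∏-distrib : ∀ n F G → ∏ n (λ i → F i ∙ G i) ≈ ∏ n F ∙ ∏ n G
  ∏-distrib zero    F G = sym (identityˡ ε)
  ∏-distrib (suc n) F G = trans (∙-congʳ (∏-distrib n F G)) (interchange _ _ _ _)

  ∏-split : ∀ a b F → ∏ (a + b) F ≈ ∏ a F ∙ ∏ b (λ i → F (a + i))
  ∏-split a zero    F = trans (reflexive (≡.cong (λ n → ∏ n F) (+-identityʳ a))) (sym (identityʳ _))
  ∏-split a (suc b) F = begin
    ∏ (a + suc b) F                                 ≡⟨ ≡.cong (λ n → ∏ n F) (+-suc a b) ⟩
    ∏ (a + b) F ∙ F (suc (a + b))                   ≈⟨ ∙-congʳ (∏-split a b F) ⟩
    (∏ a F ∙ ∏ b (λ i → F (a + i))) ∙ F (suc (a + b)) ≈⟨ assoc _ _ _ ⟩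
    ∏ a F ∙ (∏ b (λ i → F (a + i)) ∙ F (suc (a + b)))
      ≡⟨ ≡.cong (λ x → ∏ a F ∙ (∏ b (λ i → F (a + i)) ∙ F x)) (+-suc a b) ⟨
    ∏ a F ∙ ∏ (suc b) (λ i → F (a + i))             ∎

  ∏-suc : ∀ n F → ∏ (suc n) F ≈ F 1 ∙ ∏ n (F ∘ suc)
  ∏-suc n F = trans (∏-split 1 n F) (∙-congʳ (identityˡ (F 1)))

  ∏-reverse : ∀ n F → ∏ n F ≈ ∏ n (λ i → F (suc n ∸ i))
  ∏-reverse zero    F = refl
  ∏-reverse (suc n) F = begin
    ∏ (suc n) F                                   ≈⟨ ∏-suc n F ⟩
    F 1 ∙ ∏ n (F ∘ suc)                           ≈⟨ comm _ _ ⟩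
    ∏ n (F ∘ suc) ∙ F 1                           ≈⟨ ∙-congʳ (∏-reverse n (F ∘ suc)) ⟩
    ∏ n (λ i → F (suc (suc n ∸ i))) ∙ F 1         ≈⟨ ∙-congʳ (∏-cong n (λ i (_ , i≤n) →
                                                      reflexive (≡.cong F (≡.sym (+-∸-assoc 1 (m≤n⇒m≤1+n i≤n)))))) ⟩
    ∏ n (λ i → F (suc (suc n) ∸ i)) ∙ F 1         ≡⟨ ≡.cong (λ x → ∏ n (λ i → F (suc (suc n) ∸ i)) ∙ F x)
                                                               (m+n∸n≡m 1 (suc n)) ⟨
    ∏ (suc n) (λ i → F (suc (suc n) ∸ i))         ∎

  ∏-comm : ∀ m n (F : ℕ → ℕ → A) → ∏ m (λ i → ∏ n (F i)) ≈ ∏ n (λ j → ∏ m (λ i → F i j))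
  ∏-comm zero    n F = sym (∏-ε n (λ _ _ → refl))
  ∏-comm (suc m) n F =
    trans (∙-congʳ (∏-comm m n F)) (sym (∏-distrib n (λ j → ∏ m (λ i → F i j)) (F (suc m))))

  only-≡ : ∀ c F → only c F c ≡ F c
  only-≡ c F = ≡.cong (if_then F c else ε) (dec-true (c ≟ c) ≡.refl)

  only-≢ : ∀ {i c} F → i ≢ c → only c F i ≡ ε
  only-≢ {i} {c} F i≢c = ≡.cong (if_then F i else ε) (dec-false (i ≟ c) i≢c)

  ∏-only : ∀ n c F → c ∈[1, n ] → ∏ n (only c F) ≈ F c
  ∏-only zero    c F (1≤c , c≤0) = ⊥-elim (<⇒≱ 1≤c c≤0)
  ∏-only (suc n) c F c∈ with c ≟ suc n
  ... | yes ≡.refl = trans (∙-cong (∏-ε n (λ i (_ , i≤n) → reflexive (only-≢ F (<⇒≢ (s≤s i≤n)))))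
                                   (reflexive (only-≡ c F)))
                           (identityˡ (F c))
  ... | no c≢1+n   = trans (∙-cong (∏-only n c F (∈[1,]-shrink c∈ c≢1+n))
                                   (reflexive (only-≢ F (c≢1+n ∘ ≡.sym))))
                           (identityʳ (F c))

  only-erase : ∀ c F i → F i ≈ only c F i ∙ erase c F i
  only-erase c F i with does (i ≟ c)
  ... | true  = sym (identityʳ (F i))
  ... | false = sym (identityˡ (F i))

  ∏-remove : ∀ n c F → c ∈[1, n ] → ∏ n F ≈ F c ∙ ∏ n (erase c F)
  ∏-remove n c F c∈ = begin
    ∏ n F                                  ≈⟨ ∏-cong n (λ i _ → only-erase c F i) ⟩
    ∏ n (λ i → only c F i ∙ erase c F i)   ≈⟨ ∏-distrib n (only c F) (erase c F) ⟩
    ∏ n (only c F) ∙ ∏ n (erase c F)       ≈⟨ ∙-congʳ (∏-only n c F c∈) ⟩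
    F c ∙ ∏ n (erase c F)                  ∎

  -- Expand each F (g i) as a product with a single nonneutral factor and swap the two products.
  ∏-reindex : ∀ n {g g⁻¹} → IsBijectionOn n g g⁻¹ → ∀ F → ∏ n (F ∘ g) ≈ ∏ n F
  ∏-reindex n {g} {g⁻¹} bij F = begin
    ∏ n (F ∘ g)                                         ≈⟨ ∏-cong n (λ i i∈ → sym (∏-only n (g i) F (maps-into i i∈))) ⟩
    ∏ n (λ i → ∏ n (only (g i) F))                      ≈⟨ ∏-comm n n (λ i → only (g i) F) ⟩
    ∏ n (λ j → ∏ n (λ i → only (g i) F j))
      ≈⟨ ∏-cong n (λ j j∈ → ∏-cong n (λ i i∈ → transpose i j i∈ j∈)) ⟩
    ∏ n (λ j → ∏ n (only (g⁻¹ j) (λ _ → F j)))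
      ≈⟨ ∏-cong n (λ j j∈ → ∏-only n (g⁻¹ j) (λ _ → F j) (maps-into⁻¹ j j∈)) ⟩
    ∏ n F                                               ∎
    where
    open IsBijectionOn bij
    transpose : ∀ i j → i ∈[1, n ] → j ∈[1, n ] → only (g i) F j ≈ only (g⁻¹ j) (λ _ → F j) i
    transpose i j i∈ j∈ with j ≟ g i
    ... | yes ≡.refl = begin
      only (g i) F (g i)                    ≡⟨ only-≡ (g i) F ⟩
      F (g i)                               ≡⟨ only-≡ i (λ _ → F (g i)) ⟨
      only i (λ _ → F (g i)) i              ≡⟨ ≡.cong (λ x → only x (λ _ → F (g i)) i) (inverseˡ i i∈) ⟨
      only (g⁻¹ (g i)) (λ _ → F (g i)) i    ∎
    ... | no j≢gi = begin
      only (g i) F j                        ≡⟨ only-≢ F j≢gi ⟩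
      ε                                     ≡⟨ only-≢ (λ _ → F j) i≢g⁻¹j ⟨
      only (g⁻¹ j) (λ _ → F j) i            ∎
      where
      i≢g⁻¹j : i ≢ g⁻¹ j
      i≢g⁻¹j i≡g⁻¹j = j≢gi (≡.trans (≡.sym (inverseʳ j j∈)) (≡.cong g (≡.sym i≡g⁻¹j)))

  erase-≡ : ∀ c F → erase c F c ≡ ε
  erase-≡ c F = ≡.cong (if_then ε else F c) (dec-true (c ≟ c) ≡.refl)

  erase-≢ : ∀ {i c} F → i ≢ c → erase c F i ≡ F i
  erase-≢ {i} {c} F i≢c = ≡.cong (if_then ε else F i) (dec-false (i ≟ c) i≢c)

  record Cancels (n : ℕ) (ι : ℕ → ℕ) (F : ℕ → A) (i : ℕ) : Set ℓ where
    field
      partner-∈    : ι i ∈[1, n ]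
      partner-≢    : ι i ≢ i
      partner-back : ι (ι i) ≡ i
      cancels      : F i ∙ F (ι i) ≈ ε

  CancellingPairs : ℕ → (ℕ → ℕ) → (ℕ → A) → Set ℓ
  CancellingPairs n ι F = ∀ i → i ∈[1, n ] → F i ≈ ε ⊎ Cancels n ι F i

  drop-neutral : ∀ {n ι F} → CancellingPairs (suc n) ι F → F (suc n) ≈ ε → CancellingPairs n ι F
  drop-neutral {n} {ι} {F} pairs F[1+n]≈ε i i∈ with pairs i (∈[1,]-step i∈)
  ... | inj₁ Fi≈ε = inj₁ Fi≈ε
  ... | inj₂ c with ι i ≟ suc n
  ...   | yes ιi≡1+n = inj₁ (begin
          F i               ≈⟨ identityʳ (F i) ⟨
          F i ∙ ε           ≈⟨ ∙-congˡ F[1+n]≈ε ⟨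
          F i ∙ F (suc n)   ≡⟨ ≡.cong (λ x → F i ∙ F x) ιi≡1+n ⟨
          F i ∙ F (ι i)     ≈⟨ Cancels.cancels c ⟩
          ε                 ∎)
  ...   | no ιi≢1+n = inj₂ (record
            { partner-∈    = ∈[1,]-shrink partner-∈ ιi≢1+n
            ; partner-≢    = partner-≢
            ; partner-back = partner-back
            ; cancels      = cancels
            })
    where open Cancels c

  drop-pair : ∀ {n ι F} → CancellingPairs (suc n) ι F → Cancels (suc n) ι F (suc n) →
              CancellingPairs n ι (erase (ι (suc n)) F)
  drop-pair {n} {ι} {F} pairs c i i∈ with i ≟ ι (suc n)
  ... | yes ≡.refl = inj₁ (reflexive (erase-≡ i F))
  ... | no i≢j with pairs i (∈[1,]-step i∈)
  ...   | inj₁ Fi≈ε = inj₁ (trans (reflexive (erase-≢ F i≢j)) Fi≈ε)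
  ...   | inj₂ ci = inj₂ (record
            { partner-∈    = ∈[1,]-shrink partner-∈ ιi≢1+n
            ; partner-≢    = partner-≢
            ; partner-back = partner-back
            ; cancels      = trans (reflexive (≡.cong₂ _∙_ (erase-≢ F i≢j) (erase-≢ F ιi≢j))) cancels
            })
    where
    open Cancels ci
    ιi≢1+n : ι i ≢ suc n
    ιi≢1+n ιi≡1+n = i≢j (≡.trans (≡.sym partner-back) (≡.cong ι ιi≡1+n))
    ιi≢j : ι i ≢ ι (suc n)
    ιi≢j ιi≡j = <⇒≢ (s≤s (proj₂ i∈))
      (≡.trans (≡.sym partner-back) (≡.trans (≡.cong ι ιi≡j) (Cancels.partner-back c)))

  ∏-cancelling-pairs : ∀ n ι F → CancellingPairs n ι F → ∏ n F ≈ ε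
  ∏-cancelling-pairs zero    ι F pairs = refl
  ∏-cancelling-pairs (suc n) ι F pairs with pairs (suc n) (∈[1,]-last n)
  ... | inj₁ F[1+n]≈ε =
    trans (∙-cong (∏-cancelling-pairs n ι F (drop-neutral pairs F[1+n]≈ε)) F[1+n]≈ε) (identityˡ ε)
  ... | inj₂ c = begin
    ∏ n F ∙ F (suc n)                       ≈⟨ ∙-congʳ (∏-remove n j F (∈[1,]-shrink partner-∈ partner-≢)) ⟩
    (F j ∙ ∏ n (erase j F)) ∙ F (suc n)     ≈⟨ ∙-congʳ (comm _ _) ⟩
    (∏ n (erase j F) ∙ F j) ∙ F (suc n)     ≈⟨ assoc _ _ _ ⟩
    ∏ n (erase j F) ∙ (F j ∙ F (suc n))     ≈⟨ ∙-cong (∏-cancelling-pairs n ι (erase j F) (drop-pair pairs c))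
                                                      (trans (comm _ _) cancels) ⟩
    ε ∙ ε                                   ≈⟨ identityˡ ε ⟩
    ε                                       ∎
    where
    open Cancels c
    j : ℕ
    j = ι (suc n)

open IntervalProduct +-0-commutativeMonoid
  using () renaming (∏ to ∑; ∏-cong to ∑-cong; ∏-ε to ∑-0; ∏-distrib to ∑-distrib; ∏-split to ∑-split;
                     ∏-reverse to ∑-reverse; ∏-comm to ∑-comm; ∏-only to ∑-only; only to only⁺;
                     only-≡ to only⁺-≡; only-≢ to only⁺-≢)

-- Inversions of a centrally symmetric map

sum-concatMap : ∀ (G : ℕ → List ℕ) xs → sum (concatMap G xs) ≡ sum (map (sum ∘ G) xs)
sum-concatMap G []       = ≡.refl
sum-concatMap G (x ∷ xs) = ≡.trans (sum-++ (G x) (concatMap G xs)) (≡.cong (_+_ (sum (G x))) (sum-concatMap G xs))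

sum-map-upTo : ∀ n G → sum (map G (upTo n)) ≡ ∑ n (G ∘ pred)
sum-map-upTo zero    G = ≡.refl
sum-map-upTo (suc n) G = begin
  sum (map G (upTo (suc n)))          ≡⟨ ≡.cong (sum ∘ map G) (upTo-∷ʳ n) ⟨
  sum (map G (upTo n ++ [ n ]))       ≡⟨ ≡.cong sum (map-++ G (upTo n) [ n ]) ⟩
  sum (map G (upTo n) ++ [ G n ])     ≡⟨ sum-++ (map G (upTo n)) [ G n ] ⟩
  sum (map G (upTo n)) + (G n + 0)    ≡⟨ ≡.cong₂ _+_ (sum-map-upTo n G) (+-identityʳ (G n)) ⟩
  ∑ n (G ∘ pred) + G n                ∎
  where open ≡.≡-Reasoning

sum-map-range : ∀ a b G → sum (map G (range a b)) ≡ ∑ (b ∸ a) (λ j → G (a + pred j))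
sum-map-range a b G = ≡.trans (≡.cong sum (≡.sym (map-∘ (upTo (b ∸ a))))) (sum-map-upTo (b ∸ a) (λ x → G (a + x)))

∑-from : ∀ {i m} (G : ℕ → ℕ) → i ≤ m → ∑ (m ∸ i) (λ j → G (i + j)) ≡ ∑ m (λ j → 𝟙[ i <? j ] * G j)
∑-from {i} {m} G i≤m = begin
  ∑ (m ∸ i) (λ j → G (i + j))           ≡⟨ ∑-cong (m ∸ i) (λ j (1≤j , _) → ≡.sym (H-above (m<m+n i 1≤j))) ⟩
  ∑ (m ∸ i) (λ j → H (i + j))           ≡⟨ ≡.cong (_+ ∑ (m ∸ i) (λ j → H (i + j))) ∑-below ⟨
  ∑ i H + ∑ (m ∸ i) (λ j → H (i + j))   ≡⟨ ∑-split i (m ∸ i) H ⟨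
  ∑ (i + (m ∸ i)) H                     ≡⟨ ≡.cong (λ n → ∑ n H) (m+[n∸m]≡n i≤m) ⟩
  ∑ m H                                 ∎
  where
  open ≡.≡-Reasoning
  H : ℕ → ℕ
  H j = 𝟙[ i <? j ] * G j
  H-above : ∀ {j} → i < j → H j ≡ G j
  H-above {j} i<j = ≡.trans (≡.cong (_* G j) (𝟙-yes (i <? j) i<j)) (+-identityʳ (G j))
  ∑-below : ∑ i H ≡ 0
  ∑-below = ∑-0 i (λ j (_ , j≤i) → ≡.cong (_* G j) (𝟙-no (i <? j) (≤⇒≯ j≤i)))

sum-range-from : ∀ {i m} (G : ℕ → ℕ) → i ≤ m → sum (map G (range (suc i) (suc m))) ≡ ∑ m (λ j → 𝟙[ i <? j ] * G j)
sum-range-from {i} {m} G i≤m = ≡.trans (sum-map-range (suc i) (suc m) G)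
  (≡.trans (∑-cong (m ∸ i) (λ { (suc j) _ → ≡.cong G (≡.sym (+-suc i j)) })) (∑-from G i≤m))

inversions≡∑∑ : ∀ m f → inversions m f ≡ ∑ m (λ i → ∑ m (λ j → 𝟙[ i <? j ] * 𝟙[ f j <? f i ]))
inversions≡∑∑ m f = begin
  inversions m f                                        ≡⟨ sum-concatMap row (range 1 (suc m)) ⟩
  sum (map (sum ∘ row) (range 1 (suc m)))               ≡⟨ sum-map-range 1 (suc m) (sum ∘ row) ⟩
  ∑ m (λ i → sum (row (1 + pred i)))                    ≡⟨ ∑-cong m (λ { (suc i) (_ , 1+i≤m) → sum-range-from _ 1+i≤m }) ⟩
  ∑ m (λ i → ∑ m (λ j → 𝟙[ i <? j ] * 𝟙[ f j <? f i ])) ∎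
  where
  open ≡.≡-Reasoning
  row : ℕ → List ℕ
  row i = map (λ j → 𝟙[ f j <? f i ]) (range (suc i) (suc m))

module CentralSymmetry (h : ℕ) (f : ℕ → ℕ)
  (f-bounded   : ∀ i → i ∈[1, h + h ] → f i ≤ suc (h + h))
  (f-symmetric : ∀ i → i ∈[1, h + h ] → f (suc (h + h) ∸ i) ≡ suc (h + h) ∸ f i) where

  private
    m p : ℕ
    m = h + h
    p = suc m

  open ≡.≡-Reasoning

  inversion : ℕ → ℕ → ℕ
  inversion i j = 𝟙[ i <? j ] * 𝟙[ f j <? f i ]

  ∑∑ : (ℕ → ℕ → ℕ) → ℕ
  ∑∑ T = ∑ m (λ i → ∑ m (T i))

  ∑∑-cong : ∀ {T U} → (∀ i j → i ∈[1, m ] → j ∈[1, m ] → T i j ≡ U i j) → ∑∑ T ≡ ∑∑ U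
  ∑∑-cong T≡U = ∑-cong m (λ i i∈ → ∑-cong m (λ j j∈ → T≡U i j i∈ j∈))

  ∑∑-distrib : ∀ T U → ∑∑ (λ i j → T i j + U i j) ≡ ∑∑ T + ∑∑ U
  ∑∑-distrib T U = ≡.trans (∑-cong m (λ i _ → ∑-distrib m (T i) (U i))) (∑-distrib m _ _)

  below diagonal above : ℕ
  below    = ∑∑ (λ i j → inversion i j * 𝟙[ i + j <? p ])
  diagonal = ∑∑ (λ i j → inversion i j * 𝟙[ i + j ≟ p ])
  above    = ∑∑ (λ i j → inversion i j * 𝟙[ p <? i + j ])

  inversions-trichotomy : ∑∑ inversion ≡ below + diagonal + above
  inversions-trichotomy = begin
    ∑∑ inversion
      ≡⟨ ∑∑-cong (λ i j _ _ → split (inversion i j) (𝟙-trichotomy (i + j) p)) ⟩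
    ∑∑ (λ i j → inversion i j * 𝟙[ i + j <? p ] + inversion i j * 𝟙[ i + j ≟ p ] + inversion i j * 𝟙[ p <? i + j ])
      ≡⟨ ∑∑-distrib _ _ ⟩
    ∑∑ (λ i j → inversion i j * 𝟙[ i + j <? p ] + inversion i j * 𝟙[ i + j ≟ p ]) + above
      ≡⟨ ≡.cong (_+ above) (∑∑-distrib _ _) ⟩
    below + diagonal + above
      ∎
    where
    split : ∀ a {x y z} → x + y + z ≡ 1 → a ≡ a * x + a * y + a * z
    split a {x} {y} {z} x+y+z≡1 = ≡.trans (≡.sym (≡.trans (≡.cong (a *_) x+y+z≡1) (*-identityʳ a))) (distrib a x y z)
      where
      distrib : ∀ a x y z → a * (x + y + z) ≡ a * x + a * y + a * z
      distrib = solve-∀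

  reflect-∈ : ∀ {i} → i ∈[1, m ] → p ∸ i ∈[1, m ]
  reflect-∈ (1≤i , i≤m) = m<n⇒0<n∸m (s≤s i≤m) , ∸-monoʳ-≤ p 1≤i

  reflect-+ : ∀ {i} → i ∈[1, m ] → (p ∸ i) + i ≡ p
  reflect-+ (_ , i≤m) = m∸n+n≡m (m≤n⇒m≤1+n i≤m)

  inversion-reflect : ∀ {a b} → a ∈[1, m ] → b ∈[1, m ] → inversion (p ∸ b) (p ∸ a) ≡ inversion a b
  inversion-reflect {a} {b} a∈ b∈ = ≡.cong₂ _*_
    (𝟙-transpose (p ∸ b) (p ∸ a) b a (≡.trans (reflect-+ b∈) (≡.sym (reflect-+ a∈))))
    (≡.trans (≡.cong₂ (λ x y → 𝟙[ x <? y ]) (f-symmetric a a∈) (f-symmetric b b∈))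
             (𝟙-transpose (p ∸ f a) (p ∸ f b) (f a) (f b)
                          (≡.trans (m∸n+n≡m (f-bounded a a∈)) (≡.sym (m∸n+n≡m (f-bounded b b∈))))))

  above≡below : above ≡ below
  above≡below = begin
    above                                          ≡⟨ ∑-reverse m (λ i → ∑ m (A i)) ⟩
    ∑ m (λ i → ∑ m (A (p ∸ i)))                    ≡⟨ ∑-cong m (λ i _ → ∑-reverse m (A (p ∸ i))) ⟩
    ∑ m (λ i → ∑ m (λ j → A (p ∸ i) (p ∸ j)))      ≡⟨ ∑-comm m m (λ i j → A (p ∸ i) (p ∸ j)) ⟩
    ∑ m (λ a → ∑ m (λ b → A (p ∸ b) (p ∸ a)))      ≡⟨ ∑∑-cong reflect ⟩
    below                                          ∎
    where
    A : ℕ → ℕ → ℕ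
    A i j = inversion i j * 𝟙[ p <? i + j ]
    rearrange : ∀ x y a b → x + y + (a + b) ≡ (x + b) + (y + a)
    rearrange = solve-∀
    sum-of-reflections : ∀ {a b} → a ∈[1, m ] → b ∈[1, m ] → p + p ≡ (p ∸ b) + (p ∸ a) + (a + b)
    sum-of-reflections {a} {b} a∈ b∈ =
      ≡.sym (≡.trans (rearrange (p ∸ b) (p ∸ a) a b) (≡.cong₂ _+_ (reflect-+ b∈) (reflect-+ a∈)))
    reflect : ∀ a b → a ∈[1, m ] → b ∈[1, m ] → A (p ∸ b) (p ∸ a) ≡ inversion a b * 𝟙[ a + b <? p ]
    reflect a b a∈ b∈ = ≡.cong₂ _*_ (inversion-reflect a∈ b∈)
      (𝟙-transpose p ((p ∸ b) + (p ∸ a)) p (a + b) (sum-of-reflections a∈ b∈))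

  p∸y<y⇒h<y : ∀ {y} → y ≤ p → p ∸ y < y → h < y
  p∸y<y⇒h<y {y} y≤p p∸y<y = ≰⇒> (λ y≤h → <⇒≱ p∸y<y (≤-trans y≤h (≤-trans (n≤1+n h)
                                          (≤-trans (≤-reflexive (≡.sym (m+n∸n≡m (suc h) h))) (∸-monoʳ-≤ p y≤h)))))

  h<y⇒p∸y<y : ∀ {y} → h < y → p ∸ y < y
  h<y⇒p∸y<y {y} h<y = ≤-<-trans (≤-trans (∸-monoʳ-≤ p h<y) (≤-reflexive (m+n∸n≡m h h))) h<y

  diagonal≡ : diagonal ≡ ∑ h (λ i → 𝟙[ h <? f i ])
  diagonal≡ = begin
    diagonal                                                       ≡⟨ ∑-cong m (λ i i∈ → on-diagonal i∈) ⟩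
    ∑ (h + h) (λ i → inversion i (p ∸ i))                          ≡⟨ ∑-split h h _ ⟩
    ∑ h (λ i → inversion i (p ∸ i)) + ∑ h (λ i → inversion (h + i) (p ∸ (h + i)))
                                                                   ≡⟨ ≡.cong₂ _+_ (∑-cong h lower-half) (∑-0 h upper-half) ⟩
    ∑ h (λ i → 𝟙[ h <? f i ]) + 0                                  ≡⟨ +-identityʳ _ ⟩
    ∑ h (λ i → 𝟙[ h <? f i ])                                      ∎
    where
    *𝟙≡only : ∀ c F j → F j * 𝟙[ j ≟ c ] ≡ only⁺ c F j
    *𝟙≡only c F j with j ≟ c
    ... | yes ≡.refl = ≡.trans (≡.cong (F j *_) (𝟙-yes (j ≟ j) ≡.refl))
                               (≡.trans (*-identityʳ (F j)) (≡.sym (only⁺-≡ j F)))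
    ... | no  j≢c    = ≡.trans (≡.cong (F j *_) (𝟙-no (j ≟ c) j≢c))
                               (≡.trans (*-zeroʳ (F j)) (≡.sym (only⁺-≢ F j≢c)))
    on-diagonal : ∀ {i} → i ∈[1, m ] → ∑ m (λ j → inversion i j * 𝟙[ i + j ≟ p ]) ≡ inversion i (p ∸ i)
    on-diagonal {i} i∈ = ≡.trans
      (∑-cong m (λ j _ → ≡.trans (≡.cong (inversion i j *_) (𝟙-cong (i + j ≟ p) (j ≟ p ∸ i) (i+j≡p⇒ j) (⇒i+j≡p j)))
                                 (*𝟙≡only (p ∸ i) (inversion i) j)))
      (∑-only m (p ∸ i) (inversion i) (reflect-∈ i∈))
      where
      i+j≡p⇒ : ∀ j → i + j ≡ p → j ≡ p ∸ i
      i+j≡p⇒ j i+j≡p = ≡.trans (≡.sym (m+n∸m≡n i j)) (≡.cong (_∸ i) i+j≡p)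
      ⇒i+j≡p : ∀ j → j ≡ p ∸ i → i + j ≡ p
      ⇒i+j≡p j j≡p∸i = ≡.trans (≡.cong (_+_ i) j≡p∸i) (≡.trans (+-comm i (p ∸ i)) (reflect-+ i∈))
    lower-half : ∀ i → i ∈[1, h ] → inversion i (p ∸ i) ≡ 𝟙[ h <? f i ]
    lower-half i i∈@(1≤i , i≤h) = begin
      𝟙[ i <? p ∸ i ] * 𝟙[ f (p ∸ i) <? f i ]
        ≡⟨ ≡.cong₂ _*_ (𝟙-yes (i <? p ∸ i) (m+n≤o⇒m≤o∸n (suc i) (s≤s (+-mono-≤ i≤h i≤h))))
                       (≡.cong (λ x → 𝟙[ x <? f i ]) (f-symmetric i i∈m)) ⟩
      1 * 𝟙[ p ∸ f i <? f i ]
        ≡⟨ +-identityʳ _ ⟩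
      𝟙[ p ∸ f i <? f i ]
        ≡⟨ 𝟙-cong (p ∸ f i <? f i) (h <? f i) (p∸y<y⇒h<y (f-bounded i i∈m)) h<y⇒p∸y<y ⟩
      𝟙[ h <? f i ]                             ∎
      where
      i∈m : i ∈[1, m ]
      i∈m = 1≤i , ≤-trans i≤h (m≤m+n h h)
    upper-half : ∀ i → i ∈[1, h ] → inversion (h + i) (p ∸ (h + i)) ≡ 0
    upper-half i (1≤i , _) = ≡.cong (_* 𝟙[ f (p ∸ (h + i)) <? f (h + i) ]) (𝟙-no (h + i <? p ∸ (h + i))
      (≤⇒≯ (m≤n+o⇒m∸n≤o p (h + i) (+-mono-≤ (m<m+n h 1≤i) (m≤m+n h i)))))

  inversions-parity : inversions m f ≡ ∑ h (λ i → 𝟙[ h <? f i ]) + (below + below)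
  inversions-parity = begin
    inversions m f                   ≡⟨ inversions≡∑∑ m f ⟩
    ∑∑ inversion                     ≡⟨ inversions-trichotomy ⟩
    below + diagonal + above         ≡⟨ ≡.cong₂ (λ d a → below + d + a) diagonal≡ above≡below ⟩
    below + μ + below                ≡⟨ rearrange below μ ⟩
    μ + (below + below)              ∎
    where
    μ = ∑ h (λ i → 𝟙[ h <? f i ])
    rearrange : ∀ b μ → b + μ + b ≡ μ + (b + b)
    rearrange = solve-∀

sgn-centrally-symmetric : ∀ h f →
  (∀ i → i ∈[1, h + h ] → f i ≤ suc (h + h)) →
  (∀ i → i ∈[1, h + h ] → f (suc (h + h) ∸ i) ≡ suc (h + h) ∸ f i) →
  sgn (h + h) f ≡ neg1^ (∑ h (λ i → 𝟙[ h <? f i ]))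
sgn-centrally-symmetric h f f-bounded f-symmetric =
  ≡.trans (≡.cong neg1^ inversions-parity) (neg1^-+-even (∑ h (λ i → 𝟙[ h <? f i ])) below)
  where open CentralSymmetry h f f-bounded f-symmetric

-- Arithmetic modulo p

module Modulo (p : ℕ) .{{_ : NonZero p}} where

  infix 4 _≈_ _≉_
  -- A record rather than a synonym for a % p ≡ b % p, so that a and b can be inferred.
  record _≈_ (a b : ℕ) : Set where
    constructor mk≈
    field %≡% : a % p ≡ b % p
  open _≈_ public

  _≉_ : ℕ → ℕ → Set
  a ≉ b = ¬ (a ≈ b)

  ≈-setoid : Setoid 0ℓ 0ℓ
  ≈-setoid = record
    { Carrier       = ℕ
    ; _≈_           = _≈_
    ; isEquivalence = record
      { refl  = mk≈ ≡.refl
      ; sym   = λ (mk≈ a≡b) → mk≈ (≡.sym a≡b)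
      ; trans = λ (mk≈ a≡b) (mk≈ b≡c) → mk≈ (≡.trans a≡b b≡c)
      }
    }

  open Setoid ≈-setoid public using () renaming (refl to ≈-refl; sym to ≈-sym; trans to ≈-trans; reflexive to ≡⇒≈)

  %-≈ : ∀ a → a % p ≈ a
  %-≈ a = mk≈ (m%n%n≡m%n a p)

  +-cong-≈ : ∀ {a b c d} → a ≈ b → c ≈ d → a + c ≈ b + d
  +-cong-≈ {a} {b} {c} {d} (mk≈ a≈b) (mk≈ c≈d) = mk≈ $ begin
    (a + c) % p                ≡⟨ %-distribˡ-+ a c p ⟩
    (a % p + c % p) % p        ≡⟨ ≡.cong₂ (λ x y → (x + y) % p) a≈b c≈d ⟩
    (b % p + d % p) % p        ≡⟨ %-distribˡ-+ b d p ⟨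
    (b + d) % p                ∎
    where open ≡.≡-Reasoning

  *-cong-≈ : ∀ {a b c d} → a ≈ b → c ≈ d → a * c ≈ b * d
  *-cong-≈ {a} {b} {c} {d} (mk≈ a≈b) (mk≈ c≈d) = mk≈ $ begin
    (a * c) % p                ≡⟨ %-distribˡ-* a c p ⟩
    (a % p * (c % p)) % p      ≡⟨ ≡.cong₂ (λ x y → (x * y) % p) a≈b c≈d ⟩
    (b % p * (d % p)) % p      ≡⟨ %-distribˡ-* b d p ⟨
    (b * d) % p                ∎
    where open ≡.≡-Reasoning

  *-congˡ-≈ : ∀ a {b c} → b ≈ c → a * b ≈ a * c
  *-congˡ-≈ a = *-cong-≈ {a} (mk≈ ≡.refl)

  *-congʳ-≈ : ∀ {a b} c → a ≈ b → a * c ≈ b * c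
  *-congʳ-≈ c a≈b = *-cong-≈ {c = c} a≈b (mk≈ ≡.refl)

  ^-cong-≈ : ∀ {a b} n → a ≈ b → a ^ n ≈ b ^ n
  ^-cong-≈ zero    a≈b = ≈-refl
  ^-cong-≈ (suc n) a≈b = *-cong-≈ a≈b (^-cong-≈ n a≈b)

  *-commutativeMonoid : CommutativeMonoid 0ℓ 0ℓ
  *-commutativeMonoid = record
    { _≈_ = _≈_
    ; _∙_ = _*_
    ; ε   = 1
    ; isCommutativeMonoid = record
      { isMonoid = record
        { isSemigroup = record
          { isMagma = record { isEquivalence = Setoid.isEquivalence ≈-setoid ; ∙-cong = *-cong-≈ }
          ; assoc   = λ a b c → ≡⇒≈ (*-assoc a b c)
          }
        ; identity = (λ a → ≡⇒≈ (*-identityˡ a)) , (λ a → ≡⇒≈ (*-identityʳ a))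
        }
      ; comm = λ a b → ≡⇒≈ (*-comm a b)
      }
    }

  open IntervalProduct *-commutativeMonoid public

  ∏-const : ∀ n a → ∏ n (λ _ → a) ≡ a ^ n
  ∏-const zero    a = ≡.refl
  ∏-const (suc n) a = ≡.trans (≡.cong (_* a) (∏-const n a)) (*-comm (a ^ n) a)

  ∏-^ : ∀ n F k → ∏ n (λ i → F i ^ k) ≡ ∏ n F ^ k
  ∏-^ zero    F k = ≡.sym (^-zeroˡ k)
  ∏-^ (suc n) F k = ≡.trans (≡.cong (_* F (suc n) ^ k) (∏-^ n F k)) (≡.sym (*-^-distrib (∏ n F) (F (suc n)) k))

  ∏-^-exponent : ∀ n a e → ∏ n (λ i → a ^ e i) ≡ a ^ ∑ n e
  ∏-^-exponent zero    a e = ≡.refl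
  ∏-^-exponent (suc n) a e =
    ≡.trans (≡.cong (_* a ^ e (suc n)) (∏-^-exponent n a e)) (≡.sym (^-distribˡ-+-* a (∑ n e) (e (suc n))))

  open import Relation.Binary.Reasoning.Setoid ≈-setoid public

  -- ν plays the role of -1.
  ν : ℕ
  ν = p ∸ 1

  1+ν≡p : suc ν ≡ p
  1+ν≡p = m+[n∸m]≡n (>-nonZero⁻¹ p)

  0%p≡0 : 0 % p ≡ 0
  0%p≡0 = m<n⇒m%n≡m (>-nonZero⁻¹ p)

  *p≈0 : ∀ a → a * p ≈ 0
  *p≈0 a = mk≈ (≡.trans (m*n%n≡0 a p) (≡.sym 0%p≡0))

  p≈0 : p ≈ 0
  p≈0 = ≈-trans (≡⇒≈ (≡.sym (*-identityˡ p))) (*p≈0 1)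

  +-cancelʳ-≈ : ∀ {a b} c → a + c ≈ b + c → a ≈ b
  +-cancelʳ-≈ {a} {b} c a+c≈b+c = begin
    a                   ≈⟨ mk≈ ([m+kn]%n≡m%n a c p) ⟨
    a + c * p           ≡⟨ shift a ⟩
    (a + c) + c * ν     ≈⟨ +-cong-≈ a+c≈b+c ≈-refl ⟩
    (b + c) + c * ν     ≡⟨ shift b ⟨
    b + c * p           ≈⟨ mk≈ ([m+kn]%n≡m%n b c p) ⟩
    b                   ∎
    where
    shift : ∀ x → x + c * p ≡ (x + c) + c * ν
    shift x = ≡.trans (≡.cong (λ q → x + c * q) (≡.sym 1+ν≡p)) (+-*-rearrange x c ν)
      where
      +-*-rearrange : ∀ x c ν → x + c * suc ν ≡ (x + c) + c * ν
      +-*-rearrange = solve-∀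

  ∸-≈ : ∀ {y} → y ≤ p → p ∸ y ≈ ν * y
  ∸-≈ {y} y≤p = +-cancelʳ-≈ y (begin
    (p ∸ y) + y         ≡⟨ m∸n+n≡m y≤p ⟩
    p                   ≈⟨ p≈0 ⟩
    0                   ≈⟨ *p≈0 y ⟨
    y * p               ≡⟨ ≡.cong (y *_) 1+ν≡p ⟨
    y * suc ν           ≡⟨ rearrange y ν ⟩
    ν * y + y           ∎)
    where
    rearrange : ∀ y ν → y * suc ν ≡ ν * y + y
    rearrange = solve-∀

  ν*ν≈1 : ν * ν ≈ 1
  ν*ν≈1 = +-cancelʳ-≈ ν (begin
    ν * ν + ν           ≡⟨ rearrange ν ⟩
    ν * suc ν           ≡⟨ ≡.cong (ν *_) 1+ν≡p ⟩
    ν * p               ≈⟨ *p≈0 ν ⟩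
    0                   ≈⟨ p≈0 ⟨
    p                   ≡⟨ 1+ν≡p ⟨
    1 + ν               ∎)
    where
    rearrange : ∀ ν → ν * ν + ν ≡ ν * suc ν
    rearrange = solve-∀

  ν^[t+t]≈1 : ∀ t → ν ^ (t + t) ≈ 1
  ν^[t+t]≈1 t = begin
    ν ^ (t + t)         ≡⟨ ≡.cong (λ x → ν ^ (t + x)) (+-identityʳ t) ⟨
    ν ^ (2 * t)         ≡⟨ ^-*-assoc ν 2 t ⟨
    (ν * (ν * 1)) ^ t   ≡⟨ ≡.cong (λ x → (ν * x) ^ t) (*-identityʳ ν) ⟩
    (ν * ν) ^ t         ≈⟨ ^-cong-≈ t ν*ν≈1 ⟩
    1 ^ t               ≡⟨ ^-zeroˡ t ⟩
    1                   ∎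

  ν^[1+t+t]≈ν : ∀ t → ν ^ suc (t + t) ≈ ν
  ν^[1+t+t]≈ν t = ≈-trans (*-congˡ-≈ ν (ν^[t+t]≈1 t)) (≡⇒≈ (*-identityʳ ν))

module ModuloPrime (p : ℕ) (p-prime : Prime p) where

  instance
    p-nonZero : NonZero p
    p-nonZero = prime⇒nonZero p-prime

  open Modulo p public

  1<p : 1 < p
  1<p = nonTrivial⇒n>1 p {{prime⇒nonTrivial p-prime}}

  1≤ν : 1 ≤ ν
  1≤ν = ≤-pred (≤-trans 1<p (≤-reflexive (≡.sym 1+ν≡p)))

  1∈[1,ν] : 1 ∈[1, ν ]
  1∈[1,ν] = ≤-refl , 1≤ν

  ν∈[1,ν] : ν ∈[1, ν ]
  ν∈[1,ν] = 1≤ν , ≤-refl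

  <p⇒≤ν : ∀ {a} → a < p → a ≤ ν
  <p⇒≤ν a<p = ≤-pred (≤-trans a<p (≤-reflexive (≡.sym 1+ν≡p)))

  ≤ν⇒<p : ∀ {a} → a ≤ ν → a < p
  ≤ν⇒<p a≤ν = ≤-trans (s≤s a≤ν) (≤-reflexive 1+ν≡p)

  %-id : ∀ {a} → a ∈[1, ν ] → a % p ≡ a
  %-id (_ , a≤ν) = m<n⇒m%n≡m (≤ν⇒<p a≤ν)

  ≈⇒≡ : ∀ {a b} → a ∈[1, ν ] → b ∈[1, ν ] → a ≈ b → a ≡ b
  ≈⇒≡ a∈ b∈ (mk≈ a≈b) = ≡.trans (≡.sym (%-id a∈)) (≡.trans a≈b (%-id b∈))

  ∈[1,ν]⇒≉0 : ∀ {a} → a ∈[1, ν ] → a ≉ 0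
  ∈[1,ν]⇒≉0 a∈@(1≤a , _) (mk≈ a≈0) = <⇒≢ 1≤a (≡.sym (≡.trans (≡.sym (%-id a∈)) (≡.trans a≈0 0%p≡0)))

  ≉0⇒%∈[1,ν] : ∀ {a} → a ≉ 0 → a % p ∈[1, ν ]
  ≉0⇒%∈[1,ν] {a} a≉0 = n≢0⇒n>0 (λ a%p≡0 → a≉0 (mk≈ (≡.trans a%p≡0 (≡.sym 0%p≡0)))) , <p⇒≤ν (m%n<n a p)

  1≉0 : 1 ≉ 0
  1≉0 = ∈[1,ν]⇒≉0 1∈[1,ν]

  +1≈0⇒≈ν : ∀ {a} → a + 1 ≈ 0 → a ≈ ν
  +1≈0⇒≈ν a+1≈0 = +-cancelʳ-≈ 1 (≈-trans a+1≈0 (≈-sym (≈-trans (≡⇒≈ (≡.trans (+-comm ν 1) 1+ν≡p)) p≈0)))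

  inverse : ∀ {a} → a ≉ 0 → ∃[ b ] a * b ≈ 1
  inverse {a} a≉0 with coprime-Bézout (prime⇒coprime p-prime {{>-nonZero (proj₁ (≉0⇒%∈[1,ν] a≉0))}} (m%n<n a p))
  ... | Bézout.-+ x y 1+xp≡ya = y , (begin
    a * y               ≈⟨ *-congʳ-≈ y (%-≈ a) ⟨
    (a % p) * y         ≡⟨ *-comm (a % p) y ⟩
    y * (a % p)         ≡⟨ 1+xp≡ya ⟨
    1 + x * p           ≈⟨ mk≈ ([m+kn]%n≡m%n 1 x p) ⟩
    1                   ∎)
  ... | Bézout.+- x y 1+ya≡xp = y * ν , (begin
    a * (y * ν)         ≡⟨ *-assoc a y ν ⟨
    a * y * ν           ≈⟨ *-congʳ-≈ ν (+1≈0⇒≈ν ay+1≈0) ⟩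
    ν * ν               ≈⟨ ν*ν≈1 ⟩
    1                   ∎)
    where
    ay+1≈0 : a * y + 1 ≈ 0
    ay+1≈0 = begin
      a * y + 1         ≈⟨ +-cong-≈ (*-congʳ-≈ y (%-≈ a)) ≈-refl ⟨
      a % p * y + 1     ≡⟨ ≡.trans (+-comm _ 1) (≡.cong suc (*-comm (a % p) y)) ⟩
      1 + y * (a % p)   ≡⟨ 1+ya≡xp ⟩
      x * p             ≈⟨ *p≈0 x ⟩
      0                 ∎

  *-cancelʳ-≈ : ∀ {a b c} → c ≉ 0 → a * c ≈ b * c → a ≈ b
  *-cancelʳ-≈ {a} {b} {c} c≉0 ac≈bc = begin
    a                   ≡⟨ *-identityʳ a ⟨
    a * 1               ≈⟨ *-congˡ-≈ a cc⁻¹≈1 ⟨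
    a * (c * c⁻¹)       ≡⟨ *-assoc a c c⁻¹ ⟨
    a * c * c⁻¹         ≈⟨ *-congʳ-≈ c⁻¹ ac≈bc ⟩
    b * c * c⁻¹         ≡⟨ *-assoc b c c⁻¹ ⟩
    b * (c * c⁻¹)       ≈⟨ *-congˡ-≈ b cc⁻¹≈1 ⟩
    b * 1               ≡⟨ *-identityʳ b ⟩
    b                   ∎
    where
    c⁻¹ : ℕ
    c⁻¹ = proj₁ (inverse c≉0)
    cc⁻¹≈1 : c * c⁻¹ ≈ 1
    cc⁻¹≈1 = proj₂ (inverse c≉0)

  *-≉0 : ∀ {a b} → a ≉ 0 → b ≉ 0 → a * b ≉ 0
  *-≉0 {a} {b} a≉0 b≉0 ab≈0 = a≉0 (*-cancelʳ-≈ b≉0 (≈-trans ab≈0 (≡⇒≈ (≡.sym (*-zeroˡ b)))))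

  ^-≉0 : ∀ {a} n → a ≉ 0 → a ^ n ≉ 0
  ^-≉0 zero    a≉0 = 1≉0
  ^-≉0 (suc n) a≉0 = *-≉0 a≉0 (^-≉0 n a≉0)

  ∏-≉0 : ∀ n {F} → (∀ i → i ∈[1, n ] → F i ≉ 0) → ∏ n F ≉ 0
  ∏-≉0 zero    F≉0 = 1≉0
  ∏-≉0 (suc n) F≉0 = *-≉0 (∏-≉0 n (λ i → F≉0 i ∘ ∈[1,]-step)) (F≉0 (suc n) (∈[1,]-last n))

  residue-bijection : ∀ {G H} → (∀ {x y} → x ≈ y → H x ≈ H y) → (∀ {x y} → x ≈ y → G x ≈ G y) →
    (∀ i → i ∈[1, ν ] → G i ≉ 0) → (∀ j → j ∈[1, ν ] → H j ≉ 0) →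
    (∀ i → i ∈[1, ν ] → H (G i) ≈ i) → (∀ j → j ∈[1, ν ] → G (H j) ≈ j) →
    IsBijectionOn ν ((_% p) ∘ G) ((_% p) ∘ H)
  residue-bijection {G} {H} H-cong G-cong G≉0 H≉0 HG≈id GH≈id = record
    { maps-into   = λ i i∈ → ≉0⇒%∈[1,ν] (G≉0 i i∈)
    ; maps-into⁻¹ = λ j j∈ → ≉0⇒%∈[1,ν] (H≉0 j j∈)
    ; inverseˡ    = λ i i∈ → ≡.trans (%≡% (≈-trans (H-cong (%-≈ (G i))) (HG≈id i i∈))) (%-id i∈)
    ; inverseʳ    = λ j j∈ → ≡.trans (%≡% (≈-trans (G-cong (%-≈ (H j))) (GH≈id j j∈))) (%-id j∈)
    }

  fermat : ∀ {a} → a ≉ 0 → a ^ ν ≈ 1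
  fermat {a} a≉0 = *-cancelʳ-≈ (∏-≉0 ν (λ i → ∈[1,ν]⇒≉0)) (begin
    a ^ ν * ∏ ν id                   ≡⟨ ≡.cong (_* ∏ ν id) (∏-const ν a) ⟨
    ∏ ν (λ _ → a) * ∏ ν id           ≈⟨ ∏-distrib ν (λ _ → a) id ⟨
    ∏ ν (a *_)                       ≈⟨ ∏-cong ν (λ i _ → %-≈ (a * i)) ⟨
    ∏ ν ((_% p) ∘ (a *_))            ≈⟨ ∏-reindex ν (residue-bijection (*-congˡ-≈ b) (*-congˡ-≈ a)
                                           (λ i i∈ → *-≉0 a≉0 (∈[1,ν]⇒≉0 i∈))
                                           (λ j j∈ → *-≉0 b≉0 (∈[1,ν]⇒≉0 j∈))
                                           (λ i _ → x*[y*i]≈i b a ba≈1) (λ j _ → x*[y*i]≈i a b ab≈1)) id ⟩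
    ∏ ν id                           ≡⟨ *-identityˡ (∏ ν id) ⟨
    1 * ∏ ν id                       ∎)
    where
    b : ℕ
    b = proj₁ (inverse a≉0)
    ab≈1 : a * b ≈ 1
    ab≈1 = proj₂ (inverse a≉0)
    ba≈1 : b * a ≈ 1
    ba≈1 = ≈-trans (≡⇒≈ (*-comm b a)) ab≈1
    b≉0 : b ≉ 0
    b≉0 b≈0 = 1≉0 (≈-trans (≈-sym ab≈1) (≈-trans (*-congˡ-≈ a b≈0) (≡⇒≈ (*-zeroʳ a))))
    x*[y*i]≈i : ∀ x y {i} → x * y ≈ 1 → x * (y * i) ≈ i
    x*[y*i]≈i x y {i} xy≈1 =
      ≈-trans (≡⇒≈ (≡.sym (*-assoc x y i))) (≈-trans (*-congʳ-≈ i xy≈1) (≡⇒≈ (*-identityˡ i)))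

  inv : ℕ → ℕ
  inv a = a ^ (ν ∸ 1) % p

  1+[ν∸1]≡ν : suc (ν ∸ 1) ≡ ν
  1+[ν∸1]≡ν = m+[n∸m]≡n 1≤ν

  inv-inverse : ∀ {a} → a ≉ 0 → a * inv a ≈ 1
  inv-inverse {a} a≉0 = begin
    a * inv a           ≈⟨ *-congˡ-≈ a (%-≈ (a ^ (ν ∸ 1))) ⟩
    a ^ suc (ν ∸ 1)     ≡⟨ ≡.cong (a ^_) 1+[ν∸1]≡ν ⟩
    a ^ ν               ≈⟨ fermat a≉0 ⟩
    1                   ∎

  inv-∈ : ∀ {a} → a ≉ 0 → inv a ∈[1, ν ]
  inv-∈ a≉0 = ≉0⇒%∈[1,ν] (^-≉0 (ν ∸ 1) a≉0)

  inverse-unique : ∀ {a b c} → a ≉ 0 → b ∈[1, ν ] → c ∈[1, ν ] → a * b ≈ 1 → a * c ≈ 1 → b ≡ c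
  inverse-unique {a} {b} {c} a≉0 b∈ c∈ ab≈1 ac≈1 = ≈⇒≡ b∈ c∈ (*-cancelʳ-≈ a≉0 (begin
    b * a               ≡⟨ *-comm b a ⟩
    a * b               ≈⟨ ab≈1 ⟩
    1                   ≈⟨ ac≈1 ⟨
    a * c               ≡⟨ *-comm a c ⟩
    c * a               ∎))

  inv-involutive : ∀ {a} → a ∈[1, ν ] → inv (inv a) ≡ a
  inv-involutive {a} a∈ = inverse-unique inv-a≉0 (inv-∈ inv-a≉0) a∈ (inv-inverse inv-a≉0)
                            (≈-trans (≡⇒≈ (*-comm (inv a) a)) (inv-inverse (∈[1,ν]⇒≉0 a∈)))
    where
    inv-a≉0 : inv a ≉ 0
    inv-a≉0 = ∈[1,ν]⇒≉0 (inv-∈ (∈[1,ν]⇒≉0 a∈))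

  inv-ν : inv ν ≡ ν
  inv-ν = inverse-unique ν≉0 (inv-∈ ν≉0) ν∈[1,ν] (inv-inverse ν≉0) ν*ν≈1
    where
    ν≉0 : ν ≉ 0
    ν≉0 = ∈[1,ν]⇒≉0 ν∈[1,ν]

  square≈1⇒≡1 : ∀ {a} → a ∈[1, ν ∸ 1 ] → a * a ≈ 1 → a ≡ 1
  square≈1⇒≡1 {suc zero}     _                a*a≈1 = ≡.refl
  square≈1⇒≡1 {suc (suc b)} (_ , 2+b≤ν-1) a*a≈1 =
    contradiction (+-cancelʳ-≈ 1 (≈-trans (≡⇒≈ (factor b)) a*a≈1))
                  (*-≉0 (∈[1,ν]⇒≉0 (s≤s z≤n , ≤-trans (m≤n+m (suc b) 2) 3+b≤ν))
                        (∈[1,ν]⇒≉0 (s≤s z≤n , 3+b≤ν)))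
    where
    3+b≤ν : 3 + b ≤ ν
    3+b≤ν = ≤-trans (s≤s 2+b≤ν-1) (≤-reflexive 1+[ν∸1]≡ν)
    factor : ∀ b → suc b * (3 + b) + 1 ≡ suc (suc b) * suc (suc b)
    factor = solve-∀

  wilson : ∏ ν id ≈ ν
  wilson = begin
    ∏ ν id                        ≡⟨ ≡.cong (λ n → ∏ n id) 1+[ν∸1]≡ν ⟨
    ∏ (ν ∸ 1) id * suc (ν ∸ 1)    ≈⟨ *-congʳ-≈ (suc (ν ∸ 1)) (∏-cancelling-pairs (ν ∸ 1) inv id pairs) ⟩
    1 * suc (ν ∸ 1)               ≡⟨ ≡.trans (*-identityˡ _) 1+[ν∸1]≡ν ⟩
    ν                             ∎
    where
    pairs : CancellingPairs (ν ∸ 1) inv id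
    pairs i i∈ with i ≟ 1
    ... | yes ≡.refl = inj₁ ≈-refl
    ... | no i≢1     = inj₂ (record
      { partner-∈    = ∈[1,]-shrink (≡.subst (inv i ∈[1,_]) (≡.sym 1+[ν∸1]≡ν) (inv-∈ i≉0)) inv-i≢ν
      ; partner-≢    = λ inv-i≡i → i≢1 (square≈1⇒≡1 i∈ (≡.subst (λ x → i * x ≈ 1) inv-i≡i (inv-inverse i≉0)))
      ; partner-back = inv-involutive i∈ν
      ; cancels      = inv-inverse i≉0
      })
      where
      i∈ν : i ∈[1, ν ]
      i∈ν = proj₁ i∈ , ≤-trans (proj₂ i∈) (m∸n≤m ν 1)
      i≉0 : i ≉ 0
      i≉0 = ∈[1,ν]⇒≉0 i∈ν
      inv-i≢ν : inv i ≢ suc (ν ∸ 1)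
      inv-i≢ν inv-i≡ν = <⇒≢ (≤-trans (s≤s (proj₂ i∈)) (≤-reflexive 1+[ν∸1]≡ν))
        (≡.trans (≡.sym (inv-involutive i∈ν)) (≡.trans (≡.cong inv (≡.trans inv-i≡ν 1+[ν∸1]≡ν)) inv-ν))

  power-bijection : ∀ {k u v} → k * u ≡ 1 + ν * v → IsBijectionOn ν (λ i → i ^ k % p) (λ j → j ^ u % p)
  power-bijection {k} {u} {v} ku≡1+νv = residue-bijection (^-cong-≈ u) (^-cong-≈ k)
    (λ i i∈ → ^-≉0 k (∈[1,ν]⇒≉0 i∈)) (λ j j∈ → ^-≉0 u (∈[1,ν]⇒≉0 j∈))
    (λ i i∈ → ≈-trans (≡⇒≈ (^-*-assoc i k u)) (^[ku]≈id i∈))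
    (λ j j∈ → ≈-trans (≡⇒≈ (≡.trans (^-*-assoc j u k) (≡.cong (j ^_) (*-comm u k)))) (^[ku]≈id j∈))
    where
    ^[ku]≈id : ∀ {a} → a ∈[1, ν ] → a ^ (k * u) ≈ a
    ^[ku]≈id {a} a∈ = begin
      a ^ (k * u)         ≡⟨ ≡.cong (a ^_) ku≡1+νv ⟩
      a * a ^ (ν * v)     ≡⟨ ≡.cong (a *_) (^-*-assoc a ν v) ⟨
      a * (a ^ ν) ^ v     ≈⟨ *-congˡ-≈ a (^-cong-≈ v (fermat (∈[1,ν]⇒≉0 a∈))) ⟩
      a * 1 ^ v           ≡⟨ ≡.trans (≡.cong (a *_) (^-zeroˡ v)) (*-identityʳ a) ⟩
      a                   ∎

  ∸-∈ : ∀ {x} → x ∈[1, ν ] → p ∸ x ∈[1, ν ]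
  ∸-∈ (1≤x , x≤ν) = m<n⇒0<n∸m (≤ν⇒<p x≤ν) , ∸-monoʳ-≤ p 1≤x

  Odd : (ℕ → ℕ) → Set
  Odd g = ∀ x → x ∈[1, ν ] → g (p ∸ x) ≡ p ∸ g x

  power-odd : ∀ {k t} → k ≡ suc (t + t) → Odd (λ i → i ^ k % p)
  power-odd {k} {t} k≡1+2t x x∈ = ≈⇒≡ (≉0⇒%∈[1,ν] (^-≉0 k (∈[1,ν]⇒≉0 (∸-∈ x∈)))) (∸-∈ fx∈) (begin
    (p ∸ x) ^ k % p     ≈⟨ %-≈ _ ⟩
    (p ∸ x) ^ k         ≈⟨ ^-cong-≈ k (∸-≈ (<⇒≤ (≤ν⇒<p (proj₂ x∈)))) ⟩
    (ν * x) ^ k         ≡⟨ *-^-distrib ν x k ⟩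
    ν ^ k * x ^ k       ≈⟨ *-cong-≈ ν^k≈ν (≈-sym (%-≈ (x ^ k))) ⟩
    ν * (x ^ k % p)     ≈⟨ ∸-≈ (<⇒≤ (≤ν⇒<p (proj₂ fx∈))) ⟨
    p ∸ x ^ k % p       ∎)
    where
    fx∈ : x ^ k % p ∈[1, ν ]
    fx∈ = ≉0⇒%∈[1,ν] (^-≉0 k (∈[1,ν]⇒≉0 x∈))
    ν^k≈ν : ν ^ k ≈ ν
    ν^k≈ν = ≈-trans (≡⇒≈ (≡.cong (ν ^_) k≡1+2t)) (ν^[1+t+t]≈ν t)

  odd-inverse : ∀ {g g⁻¹} → IsBijectionOn ν g g⁻¹ → Odd g → Odd g⁻¹
  odd-inverse {g} {g⁻¹} bij g-odd y y∈ =
    ≡.trans (≡.cong (λ z → g⁻¹ (p ∸ z)) (≡.sym (inverseʳ y y∈)))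
      (≡.trans (≡.cong g⁻¹ (≡.sym (g-odd (g⁻¹ y) (maps-into⁻¹ y y∈))))
               (inverseˡ (p ∸ g⁻¹ y) (∸-∈ (maps-into⁻¹ y y∈))))
    where open IsBijectionOn bij

module OddPrime (h : ℕ) (p-prime : Prime (suc (h + h))) where

  open ModuloPrime (suc (h + h)) p-prime public

  p : ℕ
  p = suc (h + h)

  ν^-parity : ∀ a → (ν ^ a ≈ 1 × neg1^ a ≡ + 1) ⊎ (ν ^ a ≈ ν × neg1^ a ≡ - + 1)
  ν^-parity zero    = inj₁ (≈-refl , ≡.refl)
  ν^-parity (suc a) with ν^-parity a
  ... | inj₁ (ν^a≈1 , neg1^a≡1)  = inj₂ (≈-trans (*-congˡ-≈ ν ν^a≈1) (≡⇒≈ (*-identityʳ ν)) , ≡.cong -_ neg1^a≡1)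
  ... | inj₂ (ν^a≈ν , neg1^a≡-1) = inj₁ (≈-trans (*-congˡ-≈ ν ν^a≈ν) ν*ν≈1 , ≡.cong -_ neg1^a≡-1)

  1≉ν : 1 ≉ ν
  1≉ν 1≈ν = 1≢n+n h (≈⇒≡ 1∈[1,ν] ν∈[1,ν] 1≈ν)

  ν^≈⇒neg1^≡ : ∀ a b → ν ^ a ≈ ν ^ b → neg1^ a ≡ neg1^ b
  ν^≈⇒neg1^≡ a b ν^a≈ν^b with ν^-parity a | ν^-parity b
  ... | inj₁ (_ , sa) | inj₁ (_ , sb) = ≡.trans sa (≡.sym sb)
  ... | inj₂ (_ , sa) | inj₂ (_ , sb) = ≡.trans sa (≡.sym sb)
  ... | inj₁ (ν^a≈1 , _) | inj₂ (ν^b≈ν , _) =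
    contradiction (≈-trans (≈-sym ν^a≈1) (≈-trans ν^a≈ν^b ν^b≈ν)) 1≉ν
  ... | inj₂ (ν^a≈ν , _) | inj₁ (ν^b≈1 , _) =
    contradiction (≈-trans (≈-sym ν^b≈1) (≈-trans (≈-sym ν^a≈ν^b) ν^a≈ν)) 1≉ν

  h! : ℕ
  h! = ∏ h id

  ∏-upper-half : ∏ h (λ i → h + i) ≈ ν ^ h * h!
  ∏-upper-half = begin
    ∏ h (λ i → h + i)                    ≈⟨ ∏-cong h (λ i (_ , i≤h) →
                                              ≈-trans (≡⇒≈ (h+i≡p∸[1+h∸i] i≤h)) (∸-≈ (1+h∸i≤p i))) ⟩
    ∏ h (λ i → ν * (suc h ∸ i))          ≈⟨ ∏-distrib h (λ _ → ν) (suc h ∸_) ⟩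
    ∏ h (λ _ → ν) * ∏ h (suc h ∸_)       ≈⟨ *-cong-≈ (≡⇒≈ (∏-const h ν)) (≈-sym (∏-reverse h id)) ⟩
    ν ^ h * h!                           ∎
    where
    1+h∸i≤p : ∀ i → suc h ∸ i ≤ p
    1+h∸i≤p i = ≤-trans (m∸n≤m (suc h) i) (s≤s (m≤m+n h h))
    h+i≡p∸[1+h∸i] : ∀ {i} → i ≤ h → h + i ≡ p ∸ (suc h ∸ i)
    h+i≡p∸[1+h∸i] {i} i≤h = ≡.sym (≡.trans (≡.cong (_∸ (suc h ∸ i)) p≡) (m+n∸m≡n (suc h ∸ i) (h + i)))
      where
      rearrange : ∀ a b c → a + c + b ≡ a + (b + c)
      rearrange = solve-∀
      p≡ : p ≡ (suc h ∸ i) + (h + i)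
      p≡ = ≡.trans (≡.cong (_+ h) (≡.sym (m∸n+n≡m (m≤n⇒m≤1+n i≤h)))) (rearrange (suc h ∸ i) h i)

  h!*h!≈ν^[1+h] : h! * h! ≈ ν ^ suc h
  h!*h!≈ν^[1+h] = begin
    h! * h!                              ≡⟨ *-identityʳ (h! * h!) ⟨
    h! * h! * 1                          ≈⟨ *-congˡ-≈ (h! * h!) (ν^[t+t]≈1 h) ⟨
    h! * h! * ν ^ (h + h)                ≡⟨ ≡.cong (h! * h! *_) (^-distribˡ-+-* ν h h) ⟩
    h! * h! * (ν ^ h * ν ^ h)            ≡⟨ rearrange h! (ν ^ h) ⟩
    h! * (ν ^ h * h!) * ν ^ h            ≈⟨ *-congʳ-≈ (ν ^ h) wilson-halves ⟨
    ν * ν ^ h                            ∎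
    where
    rearrange : ∀ a b → a * a * (b * b) ≡ a * (b * a) * b
    rearrange = solve-∀
    wilson-halves : ν ≈ h! * (ν ^ h * h!)
    wilson-halves = begin
      ν                                  ≈⟨ wilson ⟨
      ∏ (h + h) id                       ≈⟨ ∏-split h h id ⟩
      h! * ∏ h (λ i → h + i)             ≈⟨ *-congˡ-≈ h! ∏-upper-half ⟩
      h! * (ν ^ h * h!)                  ∎

  -- For x ∈ [1, p - 1], ‖ x ‖ ∈ [1, h] is the absolute value of the least absolute residue of x.
  ‖_‖ : ℕ → ℕ
  ‖ x ‖ = if h <ᵇ x then p ∸ x else x

  ‖‖-low : ∀ {x} → x ≤ h → ‖ x ‖ ≡ x
  ‖‖-low {x} x≤h = ≡.cong (if_then p ∸ x else x) (dec-false (h <? x) (≤⇒≯ x≤h))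

  ‖‖-high : ∀ {x} → h < x → ‖ x ‖ ≡ p ∸ x
  ‖‖-high {x} h<x = ≡.cong (if_then p ∸ x else x) (dec-true (h <? x) h<x)

  high⇒∸-low : ∀ {x} → h < x → p ∸ x ≤ h
  high⇒∸-low {x} h<x = m≤n+o⇒m∸n≤o p x (+-monoˡ-≤ h h<x)

  low⇒∸-high : ∀ {x} → x ≤ h → h < p ∸ x
  low⇒∸-high {x} x≤h = m+n≤o⇒m≤o∸n (suc h) (s≤s (+-monoʳ-≤ h x≤h))

  ∈[1,h]⇒∈[1,ν] : ∀ {x} → x ∈[1, h ] → x ∈[1, ν ]
  ∈[1,h]⇒∈[1,ν] (1≤x , x≤h) = 1≤x , ≤-trans x≤h (m≤m+n h h)

  ‖‖-∈ : ∀ {x} → x ∈[1, ν ] → ‖ x ‖ ∈[1, h ]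
  ‖‖-∈ {x} x∈@(1≤x , _) with h <? x
  ... | yes h<x = ≡.subst (_∈[1, h ]) (≡.sym (‖‖-high h<x)) (proj₁ (∸-∈ x∈) , high⇒∸-low h<x)
  ... | no  h≮x = ≡.subst (_∈[1, h ]) (≡.sym (‖‖-low (≮⇒≥ h≮x))) (1≤x , ≮⇒≥ h≮x)

  ‖‖-∸ : ∀ {x} → x ∈[1, ν ] → ‖ p ∸ x ‖ ≡ ‖ x ‖
  ‖‖-∸ {x} x∈ with h <? x
  ... | yes h<x = ≡.trans (‖‖-low (high⇒∸-low h<x)) (≡.sym (‖‖-high h<x))
  ... | no  h≮x = ≡.trans (‖‖-high (low⇒∸-high (≮⇒≥ h≮x)))
                          (≡.trans (m∸[m∸n]≡n (<⇒≤ (≤ν⇒<p (proj₂ x∈)))) (≡.sym (‖‖-low (≮⇒≥ h≮x))))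

  ‖‖-odd : ∀ g → Odd g → ∀ {x} → x ∈[1, ν ] → g x ∈[1, ν ] → ‖ g ‖ x ‖ ‖ ≡ ‖ g x ‖
  ‖‖-odd g g-odd {x} x∈ gx∈ with h <? x
  ... | yes h<x = ≡.trans (≡.cong (‖_‖ ∘ g) (‖‖-high h<x)) (≡.trans (≡.cong ‖_‖ (g-odd x x∈)) (‖‖-∸ gx∈))
  ... | no  h≮x = ≡.cong (‖_‖ ∘ g) (‖‖-low (≮⇒≥ h≮x))

  ‖‖-bijection : ∀ {g g⁻¹} → IsBijectionOn ν g g⁻¹ → Odd g → IsBijectionOn h (‖_‖ ∘ g) (‖_‖ ∘ g⁻¹)
  ‖‖-bijection {g} {g⁻¹} bij g-odd = record
    { maps-into   = λ i i∈ → ‖‖-∈ (maps-into i (ν⊇h i∈))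
    ; maps-into⁻¹ = λ j j∈ → ‖‖-∈ (maps-into⁻¹ j (ν⊇h j∈))
    ; inverseˡ    = λ i i∈ → let gi∈ = maps-into i (ν⊇h i∈) in
        ≡.trans (‖‖-odd g⁻¹ (odd-inverse bij g-odd) gi∈ (maps-into⁻¹ (g i) gi∈))
                (≡.trans (≡.cong ‖_‖ (inverseˡ i (ν⊇h i∈))) (‖‖-low (proj₂ i∈)))
    ; inverseʳ    = λ j j∈ → let g⁻¹j∈ = maps-into⁻¹ j (ν⊇h j∈) in
        ≡.trans (‖‖-odd g g-odd g⁻¹j∈ (maps-into (g⁻¹ j) g⁻¹j∈))
                (≡.trans (≡.cong ‖_‖ (inverseʳ j (ν⊇h j∈))) (‖‖-low (proj₂ j∈)))
    }
    where
    open IsBijectionOn bij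
    ν⊇h : ∀ {x} → x ∈[1, h ] → x ∈[1, ν ]
    ν⊇h = ∈[1,h]⇒∈[1,ν]

  ≈-signed-‖‖ : ∀ {x} → x ∈[1, ν ] → x ≈ ν ^ 𝟙[ h <? x ] * ‖ x ‖
  ≈-signed-‖‖ {x} x∈ with h <? x
  ... | yes h<x = begin
    x                           ≡⟨ *-identityˡ x ⟨
    1 * x                       ≈⟨ *-congʳ-≈ x ν*ν≈1 ⟨
    ν * ν * x                   ≡⟨ ≡.trans (*-assoc ν ν x) (≡.cong (_* (ν * x)) (≡.sym (*-identityʳ ν))) ⟩
    ν ^ 1 * (ν * x)             ≈⟨ *-congˡ-≈ (ν ^ 1) (∸-≈ (<⇒≤ (≤ν⇒<p (proj₂ x∈)))) ⟨
    ν ^ 1 * (p ∸ x)             ≡⟨ ≡.cong₂ (λ e y → ν ^ e * y) (𝟙-yes (h <? x) h<x) (‖‖-high h<x) ⟨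
    ν ^ 𝟙[ h <? x ] * ‖ x ‖     ∎
  ... | no  h≮x = ≡⇒≈ (≡.sym (≡.trans (≡.cong₂ (λ e y → ν ^ e * y) (𝟙-no (h <? x) h≮x) (‖‖-low (≮⇒≥ h≮x)))
                                       (*-identityˡ x)))

  gauss-lemma : ∀ n g → (∀ i → i ∈[1, n ] → g i ∈[1, ν ]) →
                ∏ n g ≈ ν ^ ∑ n (λ i → 𝟙[ h <? g i ]) * ∏ n (‖_‖ ∘ g)
  gauss-lemma n g g∈ = begin
    ∏ n g                                              ≈⟨ ∏-cong n (λ i i∈ → ≈-signed-‖‖ (g∈ i i∈)) ⟩
    ∏ n (λ i → ν ^ 𝟙[ h <? g i ] * ‖ g i ‖)             ≈⟨ ∏-distrib n _ _ ⟩
    ∏ n (λ i → ν ^ 𝟙[ h <? g i ]) * ∏ n (‖_‖ ∘ g)       ≡⟨ ≡.cong (_* ∏ n (‖_‖ ∘ g)) (∏-^-exponent n ν _) ⟩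
    ν ^ ∑ n (λ i → 𝟙[ h <? g i ]) * ∏ n (‖_‖ ∘ g)       ∎

  power-count-parity : ∀ {k u v t} → k ≡ suc (t + t) → k * u ≡ 1 + ν * v →
                       neg1^ (∑ h (λ i → 𝟙[ h <? i ^ k % p ])) ≡ neg1^ (suc h * t)
  power-count-parity {k} {u} {v} {t} k≡1+2t ku≡1+νv = ν^≈⇒neg1^≡ μ (suc h * t) (≈-sym (begin
    ν ^ (suc h * t)                  ≡⟨ ^-*-assoc ν (suc h) t ⟨
    (ν ^ suc h) ^ t                  ≈⟨ ^-cong-≈ t h!*h!≈ν^[1+h] ⟨
    (h! * h!) ^ t                    ≡⟨ *-^-distrib h! h! t ⟩
    h! ^ t * h! ^ t                  ≡⟨ ^-distribˡ-+-* h! t t ⟨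
    h! ^ (t + t)                     ≈⟨ h!^[k-1]≈ν^μ ⟩
    ν ^ μ                            ∎))
    where
    f : ℕ → ℕ
    f i = i ^ k % p
    μ : ℕ
    μ = ∑ h (λ i → 𝟙[ h <? f i ])
    f-bijection : IsBijectionOn ν f (λ j → j ^ u % p)
    f-bijection = power-bijection {k} {u} ku≡1+νv
    ‖f‖-bijection : IsBijectionOn h (‖_‖ ∘ f) (‖_‖ ∘ (λ j → j ^ u % p))
    ‖f‖-bijection = ‖‖-bijection f-bijection (power-odd {k} {t} k≡1+2t)
    h!^[k-1]≈ν^μ : h! ^ (t + t) ≈ ν ^ μ
    h!^[k-1]≈ν^μ = *-cancelʳ-≈ (∏-≉0 h (λ i → ∈[1,ν]⇒≉0 ∘ ∈[1,h]⇒∈[1,ν])) (begin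
      h! ^ (t + t) * h!              ≡⟨ ≡.trans (*-comm (h! ^ (t + t)) h!) (≡.cong (h! ^_) (≡.sym k≡1+2t)) ⟩
      h! ^ k                         ≡⟨ ∏-^ h id k ⟨
      ∏ h (λ i → i ^ k)              ≈⟨ ∏-cong h (λ i _ → %-≈ (i ^ k)) ⟨
      ∏ h f                          ≈⟨ gauss-lemma h f (λ i → IsBijectionOn.maps-into f-bijection i ∘ ∈[1,h]⇒∈[1,ν]) ⟩
      ν ^ μ * ∏ h (‖_‖ ∘ f)          ≈⟨ *-congˡ-≈ (ν ^ μ) (∏-reindex h ‖f‖-bijection id) ⟩
      ν ^ μ * h!                     ∎)

-- The sign of i ↦ i ^ k mod p

sgn-power-map : ∀ h k t → Prime (suc (h + h)) → k ≡ suc (t + t) → gcd k (h + h) ≡ 1 →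
                sgn (h + h) (τ k (suc (h + h))) ≡ neg1^ (suc h * t)
sgn-power-map h k t p-prime k≡1+2t gcd≡1 = ≡.trans
  (sgn-centrally-symmetric h (λ i → i ^ k % p) (λ i _ → <⇒≤ (m%n<n (i ^ k) p)) (power-odd {k} {t} k≡1+2t))
  (power-count-parity {t = t} k≡1+2t (proj₂ (proj₂ uv)))
  where
  open OddPrime h p-prime
  uv : ∃[ u ] ∃[ v ] k * u ≡ 1 + (h + h) * v
  uv = bézout-positive k (h + h) (≤-trans (s≤s z≤n) (≤-reflexive (≡.sym k≡1+2t))) 1≤ν gcd≡1

coprime-to-even⇒odd : ∀ {k h} → gcd k (h + h) ≡ 1 → ∃[ t ] k ≡ suc (t + t)
coprime-to-even⇒odd {k} {h} gcd≡1 with even⊎odd k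
... | t , inj₂ k≡1+2t = t , k≡1+2t
... | t , inj₁ k≡t+t  = contradiction (∣1⇒≡1 (≡.subst (2 ∣_) gcd≡1 (gcd-greatest 2∣k (2∣n+n h)))) λ ()
  where
  2∣k : 2 ∣ k
  2∣k = ≡.subst (2 ∣_) (≡.sym k≡t+t) (2∣n+n t)

[k∸1]/2≡t : ∀ {k t} → k ≡ suc (t + t) → (k ∸ 1) / 2 ≡ t
[k∸1]/2≡t {k} {t} k≡1+2t = ≡.trans (≡.cong (λ x → (x ∸ 1) / 2) k≡1+2t) (≡.trans (≡.cong (_/ 2) (n+n≡n*2 t)) (m*n/n≡m t 2))

1+4c%4≡1 : ∀ c → suc (c + c + (c + c)) % 4 ≡ 1
1+4c%4≡1 c = ≡.trans (≡.cong (_% 4) (as-1+4c c)) ([m+kn]%n≡m%n 1 c 4)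
  where
  as-1+4c : ∀ c → suc (c + c + (c + c)) ≡ 1 + c * 4
  as-1+4c = solve-∀

3+4c%4≡3 : ∀ c → suc (suc (c + c) + suc (c + c)) % 4 ≡ 3
3+4c%4≡3 c = ≡.trans (≡.cong (_% 4) (as-3+4c c)) ([m+kn]%n≡m%n 3 c 4)
  where
  as-3+4c : ∀ c → suc (suc (c + c) + suc (c + c)) ≡ 3 + c * 4
  as-3+4c = solve-∀

neg1^[[1+2c]*t] : ∀ c t → neg1^ (suc (c + c) * t) ≡ neg1^ t
neg1^[[1+2c]*t] c t = ≡.trans (≡.cong neg1^ (expand c t)) (neg1^-+-even t (c * t))
  where
  expand : ∀ c t → suc (c + c) * t ≡ t + (c * t + c * t)
  expand = solve-∀

neg1^[[2+2c]*t] : ∀ c t → neg1^ (suc (suc (c + c)) * t) ≡ + 1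
neg1^[[2+2c]*t] c t = ≡.trans (≡.cong neg1^ (expand c t)) (neg1^-+-even 0 (suc c * t))
  where
  expand : ∀ c t → suc (suc (c + c)) * t ≡ 0 + (suc c * t + suc c * t)
  expand = solve-∀

signs-by-residue : ∀ {p} .{{_ : NonZero p}} h k → p ≡ suc (h + h) → Prime p → gcd k (p ∸ 1) ≡ 1 →
  (p % 4 ≡ 3 → sgn (p ∸ 1) (τ k p) ≡ + 1) ×
  (p % 4 ≡ 1 → sgn (p ∸ 1) (τ k p) ≡ neg1^ ((k ∸ 1) / 2))
signs-by-residue h k ≡.refl p-prime gcd≡1 with coprime-to-even⇒odd {k} {h} gcd≡1 | even⊎odd h
... | t , k≡1+2t | c , inj₁ ≡.refl =
  (λ p%4≡3 → contradiction (≡.trans (≡.sym (1+4c%4≡1 c)) p%4≡3) λ ()) ,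
  (λ _ → ≡.trans (sgn-power-map h k t p-prime k≡1+2t gcd≡1)
                 (≡.trans (neg1^[[1+2c]*t] c t) (≡.cong neg1^ (≡.sym ([k∸1]/2≡t {k} {t} k≡1+2t)))))
... | t , k≡1+2t | c , inj₂ ≡.refl =
  (λ _ → ≡.trans (sgn-power-map h k t p-prime k≡1+2t gcd≡1) (neg1^[[2+2c]*t] c t)) ,
  (λ p%4≡1 → contradiction (≡.trans (≡.sym (3+4c%4≡3 c)) p%4≡1) λ ())

theorem1p2 : (p k : ℕ) .{{_ : NonZero p}} → Prime p → p % 2 ≡ 1 → 1 ≤ k →
    gcd k (p ∸ 1) ≡ 1 →
    (p % 4 ≡ 3 → sgn (p ∸ 1) (τ k p) ≡ + 1) ×
    (p % 4 ≡ 1 → sgn (p ∸ 1) (τ k p) ≡ neg1^ ((k ∸ 1) / 2))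
theorem1p2 p k p-prime p%2≡1 _ gcd≡1 = signs-by-residue (p / 2) k (odd⇒≡1+2[n/2] p%2≡1) p-prime gcd≡1
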